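{- Let $f_{\mathrm{FR}}(n,k)$ be the number of Fubini rankings with $n$ competitors having exactly $k$ lucky cars (with $f_{\mathrm{FR}}(0,0)=1$ and $f_{\mathrm{FR}}(0,k)=0$ for $k\neq0$). Then, as formal power series, \[\sum_{n\ge0}\sum_{k\ge0} f_{\mathrm{FR}}(n,k)\,q^k\frac{x^n}{n!}=\frac{1}{1-(e^x-1)q}.\]
   Context: A Fubini ranking with $n$ competitors is a tuple $\alpha=(a_1,\ldots,a_n)\in\{1,\ldots,n\}^n$ with $a_i=1+|\{j:a_j<a_i\}|$ for every $i$. Lucky cars: cars $1,\ldots,n$ enter in order a one-way street with spots $1,\ldots,n$; car $i$ parks at spot $a_i$ if free, else at the first free spot after $a_i$; car $i$ is lucky if it parks at spot $a_i$. -}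

module Defs where

open import Data.Nat as ℕ using (ℕ; zero; suc; _!; _≤ᵇ_; _≡ᵇ_; _<ᵇ_)
open import Data.Nat.Properties using (_!≢0)
open import Data.Bool using (Bool; true; false; if_then_else_; _∧_)
open import Data.List using (List; []; _∷_; length; filter; map; concatMap; upTo; foldr)
open import Data.Integer using (+_)
open import Data.Rational as ℚ using (ℚ; 0ℚ; 1ℚ; _/_)
open import Relation.Nullary.Decidable using (Dec)
open import Relation.Binary.PropositionalEquality using (_≡_)

tuples : (m n : ℕ) → List (List ℕ)
tuples m zero    = [] ∷ []
tuples m (suc n) = concatMap (λ a → map (a ∷_) (tuples m n)) (map suc (upTo m))

countLess : List ℕ → ℕ → ℕ
countLess [] a = 0
countLess (b ∷ bs) a = (if b <ᵇ a then 1 else 0) ℕ.+ countLess bs a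

allᵇ : (ℕ → Bool) → List ℕ → Bool
allᵇ p [] = true
allᵇ p (a ∷ as) = p a ∧ allᵇ p as

isFubiniᵇ : List ℕ → Bool
isFubiniᵇ α = allᵇ (λ a → a ≡ᵇ suc (countLess α a)) α

fubiniRankings : ℕ → List (List ℕ)
fubiniRankings n = filter (λ α → Data.Bool.T? (isFubiniᵇ α)) (tuples n n)
  where import Data.Bool

memberᵇ : ℕ → List ℕ → Bool
memberᵇ s [] = false
memberᵇ s (t ∷ ts) = if s ≡ᵇ t then true else memberᵇ s ts

-- first spot ≥ a not in the occupied list (fuel suffices: fuel > length occ)
firstFree : ℕ → List ℕ → ℕ → ℕ
firstFree zero       occ a = a
firstFree (suc fuel) occ a = if memberᵇ a occ then firstFree fuel occ (suc a) else a

-- parking process on a street with spots 1..n; occ = occupied spots so far.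
-- A car finding no free spot in 1..n leaves (never happens for Fubini rankings).
luckyGo : ℕ → List ℕ → List ℕ → ℕ
luckyGo n occ [] = 0
luckyGo n occ (a ∷ as) =
  let s = firstFree (suc (length occ)) occ a in
  if s ≤ᵇ n
    then (if s ≡ᵇ a then 1 else 0) ℕ.+ luckyGo n (s ∷ occ) as
    else luckyGo n occ as

luckyCount : ℕ → List ℕ → ℕ
luckyCount n α = luckyGo n [] α

fFR : ℕ → ℕ → ℕ
fFR n k = length (filter (λ α → luckyCount n α ℕ.≟ k) (fubiniRankings n))

-- Formal power series in two variables x, q over ℚ:
-- F n k = coefficient of x^n q^k.

FPS₂ : Set
FPS₂ = ℕ → ℕ → ℚ

sumTo : ℕ → (ℕ → ℚ) → ℚ
sumTo n f = foldr (λ i acc → f i ℚ.+ acc) 0ℚ (upTo (suc n))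

_⊛_ : FPS₂ → FPS₂ → FPS₂
(F ⊛ G) n k = sumTo n (λ i → sumTo k (λ j → F i j ℚ.* G (n ℕ.∸ i) (k ℕ.∸ j)))

_⊕_ : FPS₂ → FPS₂ → FPS₂
(F ⊕ G) n k = F n k ℚ.+ G n k

_⊖_ : FPS₂ → FPS₂ → FPS₂
(F ⊖ G) n k = F n k ℚ.- G n k

one : FPS₂
one zero zero = 1ℚ
one _    _    = 0ℚ

qVar : FPS₂
qVar zero (suc zero) = 1ℚ
qVar _    _          = 0ℚ

invFact : ℕ → ℚ
invFact n = ((+ 1) / (n !)) {{n !≢0}}

expX : FPS₂
expX n zero    = invFact n
expX n (suc k) = 0ℚ

fubiniEGF : FPS₂
fubiniEGF n k = ((+ fFR n k) / (n !)) {{n !≢0}}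

denom : FPS₂
denom = one ⊖ ((expX ⊖ one) ⊛ qVar)

-- In a Fubini ranking every value a equals 1 + #{entries smaller than a}, so the cars preferring a
-- park, in order, at the spots a, a + 1, …, a + (multiplicity of a) − 1, and these blocks are disjoint.
-- Hence exactly the first car of each value is lucky: the lucky cars count the distinct values.
-- Deleting the competitors tied for last place from a ranking of n competitors with k + 1 distinct
-- values leaves a ranking of some m < n competitors with k values, the deleted positions being any of
-- C(n, m) choices; so f(n, k + 1) = Σ_{m<n} C(n, m) f(m, k) and f(n, 0) = [n = 0]. For the exponential
-- generating functions F_k this reads F_{k+1} = (eˣ − 1) F_k, F_0 = 1, i.e. F · (1 − (eˣ − 1) q) = 1.
module Submission where

open import Defs
open import Algebra.Bundles using (CommutativeSemiring; CommutativeRing)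
open import Data.Bool using (if_then_else_)
open import Data.Nat using (ℕ; zero; suc; _<_; z≤n; s≤s; _≡ᵇ_)
open import Function using (_∘_; id)
open import Level using (0ℓ)

-- RangeSum precedes the remaining imports so that the operators of R do not clash with those of ℕ.
module RangeSum (R : CommutativeSemiring 0ℓ 0ℓ) where
  open CommutativeSemiring R using (Carrier; _≈_; _+_; _*_; 0#)
  module R = CommutativeSemiring R

  Σ< : ℕ → (ℕ → Carrier) → Carrier
  Σ< zero    f = 0#
  Σ< (suc n) f = f 0 + Σ< n (f ∘ suc)

  Σ<-cong : ∀ n {f g : ℕ → Carrier} → (∀ {i} → i < n → f i ≈ g i) → Σ< n f ≈ Σ< n g
  Σ<-cong zero    f≈g = R.refl
  Σ<-cong (suc n) f≈g = R.+-cong (f≈g (s≤s z≤n)) (Σ<-cong n (f≈g ∘ s≤s))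

  Σ<-zero : ∀ n {f : ℕ → Carrier} → (∀ {i} → i < n → f i ≈ 0#) → Σ< n f ≈ 0#
  Σ<-zero zero    f≈0 = R.refl
  Σ<-zero (suc n) f≈0 = R.trans (R.+-cong (f≈0 (s≤s z≤n)) (Σ<-zero n (f≈0 ∘ s≤s))) (R.+-identityˡ 0#)

  Σ<-+ : ∀ n (f g : ℕ → Carrier) → Σ< n (λ i → f i + g i) ≈ Σ< n f + Σ< n g
  Σ<-+ zero    f g = R.sym (R.+-identityˡ 0#)
  Σ<-+ (suc n) f g = R.trans (R.+-congˡ (Σ<-+ n (f ∘ suc) (g ∘ suc))) (interchange (f 0) (g 0) _ _)
    where open import Algebra.Properties.CommutativeSemigroup R.+-commutativeSemigroup using (interchange)

  Σ<-*ʳ : ∀ n (f : ℕ → Carrier) c → Σ< n f * c ≈ Σ< n (λ i → f i * c)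
  Σ<-*ʳ zero    f c = R.zeroˡ c
  Σ<-*ʳ (suc n) f c = R.trans (R.distribʳ c (f 0) _) (R.+-congˡ (Σ<-*ʳ n (f ∘ suc) c))

  Σ<-suc : ∀ n (f : ℕ → Carrier) → Σ< (suc n) f ≈ Σ< n f + f n
  Σ<-suc zero    f = R.trans (R.+-identityʳ (f 0)) (R.sym (R.+-identityˡ (f 0)))
  Σ<-suc (suc n) f = R.trans (R.+-congˡ (Σ<-suc n (f ∘ suc))) (R.sym (R.+-assoc (f 0) _ _))

  Σ<-indicator : ∀ {m n} (f : ℕ → Carrier) → m < n → Σ< n (λ i → if m ≡ᵇ i then f i else 0#) ≈ f m
  Σ<-indicator {zero}  {suc n} f _ = R.trans (R.+-congˡ (Σ<-zero n (λ _ → R.refl))) (R.+-identityʳ (f 0))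
  Σ<-indicator {suc m} {suc n} f (s≤s m<n) = R.trans (R.+-identityˡ _) (Σ<-indicator (f ∘ suc) m<n)

open import Data.Bool using (Bool; true; false; T; T?; _∧_)
open import Data.Bool.Properties using (∧-assoc; ∧-zeroʳ; ∧-conicalˡ; ∧-conicalʳ; T-≡)
open import Data.Empty using (⊥-elim)
import Data.Integer as ℤ
import Data.Integer.Properties as ℤₚ
open import Data.List using (List; []; _∷_; _++_; length; map; concatMap; applyUpTo; upTo; filter; foldr)
open import Data.List.Relation.Unary.All using (All; []; _∷_)
open import Data.Nat using (_+_; _*_; _∸_; _≤_; _<ᵇ_; _≤ᵇ_; _≟_; NonZero; _!)
open import Data.Nat.Combinatorics
  using (_C_; nCk≡n!/k![n-k]!; k![n∸k]!∣n!; nCk+nC[k+1]≡[n+1]C[k+1]; k>n⇒nCk≡0; nCn≡1)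
open import Data.Nat.DivMod using (m/n*n≡m)
open import Data.Nat.Properties
  using ( +-*-commutativeSemiring; +-commutativeSemigroup; +-assoc; +-comm; +-identityʳ; +-suc
        ; *-identityˡ; *-zeroʳ; *-distribʳ-+; _!≢0; _!*_!≢0
        ; ≡⇒≡ᵇ; ≡ᵇ⇒≡; <⇒<ᵇ; <ᵇ⇒<; ≤⇒≤ᵇ
        ; ≤-refl; ≤-reflexive; ≤-trans; <-trans; <-≤-trans; ≤-<-trans; <-irrefl; <-cmp; <⇒≤; <⇒≢; >⇒≢; <⇒≱; ≤∧≢⇒<
        ; n<1+n; n≤1+n; m≤n⇒m≤1+n; m<1+n⇒m≤n; m<n⇒m<1+n; m≤n⇒m<n∨m≡n; m≤m+n; m≤n+m; m<m+n
        ; +-monoʳ-≤; +-monoʳ-<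
        ; +-∸-assoc; n∸n≡0; m+n∸n≡m; m<n⇒0<n∸m
        ; module ≤-Reasoning )
open import Data.Product using (_×_; _,_; ∃-syntax)
open import Function.Bundles using (Equivalence)
open import Data.Rational as ℚ using (ℚ; 0ℚ; 1ℚ; _/_; toℚᵘ)
import Data.Rational.Properties as ℚₚ
open import Data.Rational.Properties using (toℚᵘ-injective; toℚᵘ-fromℚᵘ; toℚᵘ-homo-+; toℚᵘ-homo-*)
open import Data.Rational.Solver using (module +-*-Solver)
open import Data.Rational.Unnormalised as ℚᵘ using (mkℚᵘ; *≡*) renaming (_≃_ to _≃ᵘ_)
import Data.Rational.Unnormalised.Properties as ℚᵘₚ
open import Data.Sum using (inj₁; inj₂)
open import Relation.Binary.Definitions using (tri<; tri≈; tri>)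
open import Relation.Binary.PropositionalEquality
  using (_≡_; _≢_; refl; sym; trans; cong; cong₂; subst; module ≡-Reasoning)
open import Relation.Nullary using (¬_; does; contradiction; yes; no)
open import Relation.Unary using (Decidable)

T⇒≡true : ∀ {b} → T b → b ≡ true
T⇒≡true = Equivalence.to T-≡

¬T⇒≡false : ∀ {b} → ¬ T b → b ≡ false
¬T⇒≡false {false} _ = refl
¬T⇒≡false {true}  ¬t = ⊥-elim (¬t _)

≡true⇒T : ∀ {b} → b ≡ true → T b
≡true⇒T = Equivalence.from T-≡

≡ᵇ-refl : ∀ n → (n ≡ᵇ n) ≡ true
≡ᵇ-refl n = T⇒≡true (≡⇒≡ᵇ n n refl)

≢⇒≡ᵇ-false : ∀ {m n} → m ≢ n → (m ≡ᵇ n) ≡ false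
≢⇒≡ᵇ-false {m} {n} m≢n = ¬T⇒≡false (m≢n ∘ ≡ᵇ⇒≡ m n)

≡ᵇ-true⇒≡ : ∀ {m n} → (m ≡ᵇ n) ≡ true → m ≡ n
≡ᵇ-true⇒≡ {m} {n} = ≡ᵇ⇒≡ m n ∘ ≡true⇒T

≡ᵇ-false⇒≢ : ∀ {m n} → (m ≡ᵇ n) ≡ false → m ≢ n
≡ᵇ-false⇒≢ {m} eq refl = contradiction (trans (sym (≡ᵇ-refl m)) eq) λ ()

<⇒<ᵇ-true : ∀ {m n} → m < n → (m <ᵇ n) ≡ true
<⇒<ᵇ-true = T⇒≡true ∘ <⇒<ᵇ

≤⇒<ᵇ-false : ∀ {m n} → m ≤ n → (n <ᵇ m) ≡ false
≤⇒<ᵇ-false {m} {n} m≤n = ¬T⇒≡false (λ t → <⇒≱ (<ᵇ⇒< n m t) m≤n)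

≤⇒≤ᵇ-true : ∀ {m n} → m ≤ n → (m ≤ᵇ n) ≡ true
≤⇒≤ᵇ-true = T⇒≡true ∘ ≤⇒≤ᵇ

[m+n≡ᵇm]≡[n≡ᵇ0] : ∀ m n → (m + n ≡ᵇ m) ≡ (n ≡ᵇ 0)
[m+n≡ᵇm]≡[n≡ᵇ0] zero    n = refl
[m+n≡ᵇm]≡[n≡ᵇ0] (suc m) n = [m+n≡ᵇm]≡[n≡ᵇ0] m n

m<n⇒n∸m≡1+[n∸1+m] : ∀ {m n} → m < n → n ∸ m ≡ suc (n ∸ suc m)
m<n⇒n∸m≡1+[n∸1+m] = +-∸-assoc 1

m≤n<m+o⇒0<o : ∀ {m n o} → m ≤ n → n < m + o → 0 < o
m≤n<m+o⇒0<o {m} {o = zero}  m≤n n<m+0 = contradiction m≤n (<⇒≱ (subst (_ <_) (+-identityʳ m) n<m+0))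
m≤n<m+o⇒0<o     {o = suc o} _   _     = s≤s z≤n

-- Sums over lists and tuples

open RangeSum +-*-commutativeSemiring

private variable A B : Set

sumOver : (A → ℕ) → List A → ℕ
sumOver f []       = 0
sumOver f (x ∷ xs) = f x + sumOver f xs

sumOver-cong : ∀ {f g : A → ℕ} xs → (∀ x → f x ≡ g x) → sumOver f xs ≡ sumOver g xs
sumOver-cong []       f≗g = refl
sumOver-cong (x ∷ xs) f≗g = cong₂ _+_ (f≗g x) (sumOver-cong xs f≗g)

sumOver-zero : ∀ (xs : List A) → sumOver (λ _ → 0) xs ≡ 0
sumOver-zero []       = refl
sumOver-zero (x ∷ xs) = sumOver-zero xs

sumOver-++ : ∀ (f : A → ℕ) xs ys → sumOver f (xs ++ ys) ≡ sumOver f xs + sumOver f ys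
sumOver-++ f []       ys = refl
sumOver-++ f (x ∷ xs) ys = trans (cong (f x +_) (sumOver-++ f xs ys)) (sym (+-assoc (f x) _ _))

sumOver-map : ∀ (f : B → ℕ) (g : A → B) xs → sumOver f (map g xs) ≡ sumOver (f ∘ g) xs
sumOver-map f g []       = refl
sumOver-map f g (x ∷ xs) = cong (f (g x) +_) (sumOver-map f g xs)

sumOver-concatMap : ∀ (f : B → ℕ) (g : A → List B) xs →
                    sumOver f (concatMap g xs) ≡ sumOver (sumOver f ∘ g) xs
sumOver-concatMap f g []       = refl
sumOver-concatMap f g (x ∷ xs) =
  trans (sumOver-++ f (g x) (concatMap g xs)) (cong (sumOver f (g x) +_) (sumOver-concatMap f g xs))

sumOver-filter : ∀ {P : A → Set} (P? : Decidable P) (f : A → ℕ) xs →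
                 sumOver f (filter P? xs) ≡ sumOver (λ x → if does (P? x) then f x else 0) xs
sumOver-filter P? f []       = refl
sumOver-filter P? f (x ∷ xs) with does (P? x)
... | true  = cong (f x +_) (sumOver-filter P? f xs)
... | false = sumOver-filter P? f xs

length≡sumOver-1 : ∀ (xs : List A) → length xs ≡ sumOver (λ _ → 1) xs
length≡sumOver-1 []       = refl
length≡sumOver-1 (x ∷ xs) = cong suc (length≡sumOver-1 xs)

sumOver-applyUpTo : ∀ (f : A → ℕ) (g : ℕ → A) n → sumOver f (applyUpTo g n) ≡ Σ< n (f ∘ g)
sumOver-applyUpTo f g zero    = refl
sumOver-applyUpTo f g (suc n) = cong (f (g 0) +_) (sumOver-applyUpTo f (g ∘ suc) n)

sumOver-tuples-suc : ∀ m n (f : List ℕ → ℕ) →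
                     sumOver f (tuples m (suc n)) ≡ Σ< m (λ a → sumOver (λ γ → f (suc a ∷ γ)) (tuples m n))
sumOver-tuples-suc m n f = begin
  sumOver f (concatMap (λ a → map (a ∷_) (tuples m n)) (map suc (upTo m)))
    ≡⟨ sumOver-concatMap f (λ a → map (a ∷_) (tuples m n)) (map suc (upTo m)) ⟩
  sumOver (λ a → sumOver f (map (a ∷_) (tuples m n))) (map suc (upTo m))
    ≡⟨ sumOver-cong (map suc (upTo m)) (λ a → sumOver-map f (a ∷_) (tuples m n)) ⟩
  sumOver (λ a → sumOver (λ γ → f (a ∷ γ)) (tuples m n)) (map suc (upTo m))
    ≡⟨ sumOver-map _ suc (upTo m) ⟩
  sumOver (λ a → sumOver (λ γ → f (suc a ∷ γ)) (tuples m n)) (upTo m)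
    ≡⟨ sumOver-applyUpTo _ id m ⟩
  Σ< m (λ a → sumOver (λ γ → f (suc a ∷ γ)) (tuples m n)) ∎
  where open ≡-Reasoning

sumOver-tuples-cong : ∀ m n {f g : List ℕ → ℕ} → (∀ γ → length γ ≡ n → All (_≤ m) γ → f γ ≡ g γ) →
                      sumOver f (tuples m n) ≡ sumOver g (tuples m n)
sumOver-tuples-cong m zero    f≗g = cong (_+ 0) (f≗g [] refl [])
sumOver-tuples-cong m (suc n) {f} {g} f≗g = begin
  sumOver f (tuples m (suc n))                              ≡⟨ sumOver-tuples-suc m n f ⟩
  Σ< m (λ a → sumOver (λ γ → f (suc a ∷ γ)) (tuples m n))
    ≡⟨ Σ<-cong m (λ a<m → sumOver-tuples-cong m n (λ γ |γ|≡n γ≤m → f≗g _ (cong suc |γ|≡n) (a<m ∷ γ≤m))) ⟩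
  Σ< m (λ a → sumOver (λ γ → g (suc a ∷ γ)) (tuples m n))  ≡⟨ sumOver-tuples-suc m n g ⟨
  sumOver g (tuples m (suc n))                              ∎
  where open ≡-Reasoning

-- pathSum n T sums T (#x w) (#y w) over the 2ⁿ words w in the letters x, y of length n.
pathSum : ℕ → (ℕ → ℕ → ℕ) → ℕ
pathSum zero    T = T 0 0
pathSum (suc n) T = pathSum n (λ i j → T (suc i) j) + pathSum n (λ i j → T i (suc j))

pathSum-cong : ∀ n {T U : ℕ → ℕ → ℕ} → (∀ i j → T i j ≡ U i j) → pathSum n T ≡ pathSum n U
pathSum-cong zero    T≗U = T≗U 0 0
pathSum-cong (suc n) T≗U = cong₂ _+_ (pathSum-cong n (λ i → T≗U (suc i))) (pathSum-cong n (λ i j → T≗U i (suc j)))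

pathSum-zero : ∀ n → pathSum n (λ _ _ → 0) ≡ 0
pathSum-zero zero    = refl
pathSum-zero (suc n) = cong₂ _+_ (pathSum-zero n) (pathSum-zero n)

pathSum-+ : ∀ n (T U : ℕ → ℕ → ℕ) → pathSum n (λ i j → T i j + U i j) ≡ pathSum n T + pathSum n U
pathSum-+ zero    T U = refl
pathSum-+ (suc n) T U = trans
  (cong₂ _+_ (pathSum-+ n (λ i → T (suc i)) (λ i → U (suc i))) (pathSum-+ n (λ i j → T i (suc j)) (λ i j → U i (suc j))))
  (+-interchange (pathSum n (λ i → T (suc i))) _ _ _)
  where open import Algebra.Properties.CommutativeSemigroup +-commutativeSemigroup renaming (interchange to +-interchange)

pathSum-Σ< : ∀ m n (T : ℕ → ℕ → ℕ → ℕ) → pathSum n (λ i j → Σ< m (λ a → T a i j)) ≡ Σ< m (λ a → pathSum n (T a))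
pathSum-Σ< zero    n T = pathSum-zero n
pathSum-Σ< (suc m) n T = trans (pathSum-+ n (T 0) _) (cong (pathSum n (T 0) +_) (pathSum-Σ< m n (T ∘ suc)))

pathSum-binomial : ∀ n (T : ℕ → ℕ → ℕ) → pathSum n T ≡ Σ< (suc n) (λ i → (n C i) * T i (n ∸ i))
pathSum-binomial zero    T = sym (trans (+-identityʳ ((0 C 0) * T 0 0)) (*-identityˡ (T 0 0)))
pathSum-binomial (suc n) T = begin
  pathSum n (λ i → T (suc i)) + pathSum n (λ i j → T i (suc j))
    ≡⟨ cong₂ _+_ (pathSum-binomial n (λ i → T (suc i))) (pathSum-binomial n (λ i j → T i (suc j))) ⟩
  Σ₁ + (t₀ + Σ₂)            ≡⟨ x∙yz≈y∙xz Σ₁ t₀ Σ₂ ⟩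
  t₀ + (Σ₁ + Σ₂)            ≡⟨ cong (λ b → t₀ + (Σ₁ + b)) Σ₂′≡Σ₂ ⟨
  t₀ + (Σ₁ + Σ₂′)           ≡⟨ cong (t₀ +_) (Σ<-+ (suc n) (λ i → (n C i) * T (suc i) (n ∸ i)) (λ i → (n C suc i) * T (suc i) (n ∸ i))) ⟨
  t₀ + Σ< (suc n) (λ i → (n C i) * T (suc i) (n ∸ i) + (n C suc i) * T (suc i) (n ∸ i))
    ≡⟨ cong (t₀ +_) (Σ<-cong (suc n) (λ {i} _ → pascal i)) ⟩
  t₀ + Σ< (suc n) (λ i → (suc n C suc i) * T (suc i) (n ∸ i)) ∎
  where
  open ≡-Reasoning
  open import Algebra.Properties.CommutativeSemigroup +-commutativeSemigroup using (x∙yz≈y∙xz)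
  t₀ Σ₁ Σ₂ Σ₂′ Σ₂″ : ℕ
  t₀ = (n C 0) * T 0 (suc n)
  Σ₁  = Σ< (suc n) (λ i → (n C i) * T (suc i) (n ∸ i))
  Σ₂  = Σ< n (λ i → (n C suc i) * T (suc i) (suc (n ∸ suc i)))
  Σ₂′ = Σ< (suc n) (λ i → (n C suc i) * T (suc i) (n ∸ i))
  Σ₂″ = Σ< n (λ i → (n C suc i) * T (suc i) (n ∸ i))
  Σ₂′≡Σ₂ : Σ₂′ ≡ Σ₂
  Σ₂′≡Σ₂ = begin
    Σ₂′                                         ≡⟨ Σ<-suc n _ ⟩
    Σ₂″ + (n C suc n) * T (suc n) (n ∸ n)         ≡⟨ cong (λ c → Σ₂″ + c * T (suc n) (n ∸ n)) (k>n⇒nCk≡0 (n<1+n n)) ⟩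
    Σ₂″ + 0                                     ≡⟨ +-identityʳ Σ₂″ ⟩
    Σ₂″                                         ≡⟨ Σ<-cong n (λ {i} i<n → cong (λ d → (n C suc i) * T (suc i) d) (m<n⇒n∸m≡1+[n∸1+m] i<n)) ⟩
    Σ₂                                          ∎
  pascal : ∀ i → (n C i) * T (suc i) (n ∸ i) + (n C suc i) * T (suc i) (n ∸ i) ≡ (suc n C suc i) * T (suc i) (n ∸ i)
  pascal i = trans (sym (*-distribʳ-+ (T (suc i) (n ∸ i)) (n C i) _)) (cong (_* T (suc i) (n ∸ i)) (nCk+nC[k+1]≡[n+1]C[k+1] n i))

-- Splitting off the largest value

multiplicity : ℕ → List ℕ → ℕ
multiplicity v []      = 0
multiplicity v (a ∷ γ) = if v ≡ᵇ a then suc (multiplicity v γ) else multiplicity v γ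

remove : ℕ → List ℕ → List ℕ
remove v []      = []
remove v (a ∷ γ) = if v ≡ᵇ a then remove v γ else a ∷ remove v γ

multiplicity-cons-≢ : ∀ {v a} s → v ≢ a → multiplicity v (a ∷ s) ≡ multiplicity v s
multiplicity-cons-≢ s v≢a rewrite ≢⇒≡ᵇ-false v≢a = refl

multiplicity-cons-≤ : ∀ v a γ → multiplicity v γ ≤ multiplicity v (a ∷ γ)
multiplicity-cons-≤ v a γ with v ≡ᵇ a
... | true  = n≤1+n _
... | false = ≤-refl

multiplicity-here : ∀ v s → multiplicity v (v ∷ s) ≡ suc (multiplicity v s)
multiplicity-here v s rewrite ≡ᵇ-refl v = refl

multiplicity-here>0 : ∀ v s → 0 < multiplicity v (v ∷ s)
multiplicity-here>0 v s rewrite ≡ᵇ-refl v = s≤s z≤n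

multiplicity≤length : ∀ v γ → multiplicity v γ ≤ length γ
multiplicity≤length v []      = z≤n
multiplicity≤length v (a ∷ γ) with v ≡ᵇ a
... | true  = s≤s (multiplicity≤length v γ)
... | false = m≤n⇒m≤1+n (multiplicity≤length v γ)

remove-All≢ : ∀ M γ → All (_≢ M) (remove M γ)
remove-All≢ M []      = []
remove-All≢ M (a ∷ γ) with M ≡ᵇ a in eq
... | true  = remove-All≢ M γ
... | false = ≡ᵇ-false⇒≢ eq ∘ sym ∷ remove-All≢ M γ

remove-multiplicity≡0 : ∀ M γ → multiplicity M γ ≡ 0 → remove M γ ≡ γ
remove-multiplicity≡0 M []      _ = refl
remove-multiplicity≡0 M (a ∷ γ) m≡0 with M ≡ᵇ a
... | false = cong (a ∷_) (remove-multiplicity≡0 M γ m≡0)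

All-remove : ∀ {P : ℕ → Set} M γ → All P γ → All P (remove M γ)
All-remove M []      []         = []
All-remove M (a ∷ γ) (pa ∷ pγ) with M ≡ᵇ a
... | true  = All-remove M γ pγ
... | false = pa ∷ All-remove M γ pγ

sumOver-tuples-pathSum : ∀ m n (h : ℕ → List ℕ → ℕ) →
  sumOver (λ γ → h (multiplicity (suc m) γ) (remove (suc m) γ)) (tuples (suc m) n) ≡
  pathSum n (λ i j → sumOver (h j) (tuples m i))
sumOver-tuples-pathSum m zero    h = refl
sumOver-tuples-pathSum m (suc n) h = begin
  sumOver H (tuples (suc m) (suc n))                                 ≡⟨ sumOver-tuples-suc (suc m) n H ⟩
  Σ< (suc m) (λ a → sumOver (λ γ → H (suc a ∷ γ)) (tuples (suc m) n)) ≡⟨ Σ<-suc m _ ⟩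
  Σ< m (λ a → sumOver (λ γ → H (suc a ∷ γ)) (tuples (suc m) n)) + sumOver (λ γ → H (suc m ∷ γ)) (tuples (suc m) n)
    ≡⟨ cong₂ _+_ (Σ<-cong m (λ {a} a<m → lower-letter a a<m)) top-letter ⟩
  Σ< m (λ a → pathSum n (Tₐ a)) + top                                 ≡⟨ cong (_+ top) (pathSum-Σ< m n Tₐ) ⟨
  pathSum n (λ i j → Σ< m (λ a → Tₐ a i j)) + top                     ≡⟨ cong (_+ top) (pathSum-cong n (λ i j → sumOver-tuples-suc m i (h j))) ⟨
  pathSum n (λ i j → sumOver (h j) (tuples m (suc i))) + top         ∎
  where
  open ≡-Reasoning
  H : List ℕ → ℕ
  H γ = h (multiplicity (suc m) γ) (remove (suc m) γ)
  Tₐ : ℕ → ℕ → ℕ → ℕ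
  Tₐ a i j = sumOver (λ β → h j (suc a ∷ β)) (tuples m i)
  top : ℕ
  top = pathSum n (λ i j → sumOver (h (suc j)) (tuples m i))
  lower-letter : ∀ a → a < m → sumOver (λ γ → H (suc a ∷ γ)) (tuples (suc m) n) ≡ pathSum n (Tₐ a)
  lower-letter a a<m rewrite ≢⇒≡ᵇ-false (>⇒≢ a<m) = sumOver-tuples-pathSum m n (λ j β → h j (suc a ∷ β))
  top-letter : sumOver (λ γ → H (suc m ∷ γ)) (tuples (suc m) n) ≡ top
  top-letter rewrite ≡ᵇ-refl m = sumOver-tuples-pathSum m n (h ∘ suc)

sumOver-tuples-binomial : ∀ m n (h : ℕ → List ℕ → ℕ) →
  sumOver (λ γ → h (multiplicity (suc m) γ) (remove (suc m) γ)) (tuples (suc m) n) ≡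
  Σ< (suc n) (λ i → (n C i) * sumOver (h (n ∸ i)) (tuples m i))
sumOver-tuples-binomial m n h = trans (sumOver-tuples-pathSum m n h) (pathSum-binomial n _)

freshCount : List ℕ → List ℕ → ℕ
freshCount seen []      = 0
freshCount seen (a ∷ γ) = (if multiplicity a seen ≡ᵇ 0 then 1 else 0) + freshCount (a ∷ seen) γ

distinctCount : List ℕ → ℕ
distinctCount = freshCount []

freshCount-cong : ∀ {P : ℕ → Set} {s s′} δ → (∀ {v} → P v → multiplicity v s ≡ multiplicity v s′) →
                  All P δ → freshCount s δ ≡ freshCount s′ δ
freshCount-cong []      s≈s′ []         = refl
freshCount-cong {P = P} {s} {s′} (a ∷ δ) s≈s′ (pa ∷ pδ) =
  cong₂ (λ c d → (if c ≡ᵇ 0 then 1 else 0) + d) (s≈s′ pa) (freshCount-cong δ extend pδ)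
  where
  extend : ∀ {v} → P v → multiplicity v (a ∷ s) ≡ multiplicity v (a ∷ s′)
  extend {v} pv = cong (λ c → if v ≡ᵇ a then suc c else c) (s≈s′ pv)

freshCount-forget : ∀ M s δ → freshCount (M ∷ s) (remove M δ) ≡ freshCount s (remove M δ)
freshCount-forget M s δ = freshCount-cong (remove M δ) (multiplicity-cons-≢ s) (remove-All≢ M δ)

freshCount-remove-seen : ∀ M s γ → 0 < multiplicity M s → freshCount s γ ≡ freshCount s (remove M γ)
freshCount-remove-seen M s []      _   = refl
freshCount-remove-seen M s (a ∷ γ) M∈s with M ≟ a
... | yes refl rewrite ≡ᵇ-refl M | ≢⇒≡ᵇ-false (>⇒≢ M∈s) =
  trans (freshCount-remove-seen M (M ∷ s) γ (multiplicity-here>0 M s)) (freshCount-forget M s γ)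
... | no M≢a rewrite ≢⇒≡ᵇ-false M≢a =
  cong ((if multiplicity a s ≡ᵇ 0 then 1 else 0) +_)
       (freshCount-remove-seen M (a ∷ s) γ (subst (0 <_) (sym (multiplicity-cons-≢ s M≢a)) M∈s))

freshCount-remove-unseen : ∀ M s γ → multiplicity M s ≡ 0 → 0 < multiplicity M γ →
                           freshCount s γ ≡ suc (freshCount s (remove M γ))
freshCount-remove-unseen M s []      _   ()
freshCount-remove-unseen M s (a ∷ γ) M∉s M∈γ with M ≟ a
... | yes refl rewrite ≡ᵇ-refl M | M∉s =
  cong suc (trans (freshCount-remove-seen M (M ∷ s) γ (multiplicity-here>0 M s)) (freshCount-forget M s γ))
... | no M≢a rewrite ≢⇒≡ᵇ-false M≢a =
  trans (cong ((if multiplicity a s ≡ᵇ 0 then 1 else 0) +_)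
              (freshCount-remove-unseen M (a ∷ s) γ (trans (multiplicity-cons-≢ s M≢a) M∉s) M∈γ))
        (+-suc _ _)

allᵇ-cong : ∀ {P : ℕ → Set} {p q : ℕ → Bool} {xs} → (∀ {a} → P a → p a ≡ q a) → All P xs → allᵇ p xs ≡ allᵇ q xs
allᵇ-cong p≗q []         = refl
allᵇ-cong p≗q (pa ∷ pxs) = cong₂ _∧_ (p≗q pa) (allᵇ-cong p≗q pxs)

allᵇ-remove : ∀ M p γ → allᵇ p γ ≡ allᵇ p (remove M γ) ∧ (if multiplicity M γ ≡ᵇ 0 then true else p M)
allᵇ-remove M p []      = refl
allᵇ-remove M p (a ∷ γ) with M ≟ a
... | yes refl rewrite ≡ᵇ-refl M =
  trans (cong (p M ∧_) (allᵇ-remove M p γ)) (absorb (p M) (allᵇ p (remove M γ)) (multiplicity M γ ≡ᵇ 0))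
  where
  absorb : ∀ x y c → x ∧ (y ∧ (if c then true else x)) ≡ y ∧ x
  absorb true  y true  = refl
  absorb true  y false = refl
  absorb false y c     = sym (∧-zeroʳ y)
... | no M≢a rewrite ≢⇒≡ᵇ-false M≢a = trans (cong (p a ∧_) (allᵇ-remove M p γ)) (sym (∧-assoc (p a) _ _))

countLess-remove : ∀ M γ {a} → a ≤ M → countLess γ a ≡ countLess (remove M γ) a
countLess-remove M []      a≤M = refl
countLess-remove M (b ∷ γ) {a} a≤M with M ≟ b
... | yes refl rewrite ≡ᵇ-refl M | ≤⇒<ᵇ-false a≤M = countLess-remove M γ a≤M
... | no M≢b   rewrite ≢⇒≡ᵇ-false M≢b = cong ((if b <ᵇ a then 1 else 0) +_) (countLess-remove M γ a≤M)

countLess-max : ∀ M γ → All (_≤ M) γ → countLess γ M ≡ length (remove M γ)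
countLess-max M []      []           = refl
countLess-max M (b ∷ γ) (b≤M ∷ γ≤M) with M ≟ b
... | yes refl rewrite ≡ᵇ-refl M | ≤⇒<ᵇ-false (≤-refl {M}) = countLess-max M γ γ≤M
... | no M≢b   rewrite ≢⇒≡ᵇ-false M≢b | <⇒<ᵇ-true (≤∧≢⇒< b≤M (M≢b ∘ sym)) = cong suc (countLess-max M γ γ≤M)

isFubiniᵇ-remove-max : ∀ M γ → All (_≤ M) γ → 0 < multiplicity M γ →
                       isFubiniᵇ γ ≡ isFubiniᵇ (remove M γ) ∧ (M ≡ᵇ suc (length (remove M γ)))
isFubiniᵇ-remove-max M γ γ≤M M∈γ = begin
  allᵇ (rank γ) γ
    ≡⟨ allᵇ-remove M (rank γ) γ ⟩
  allᵇ (rank γ) (remove M γ) ∧ (if multiplicity M γ ≡ᵇ 0 then true else rank γ M)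
    ≡⟨ cong (λ b → allᵇ (rank γ) (remove M γ) ∧ (if b then true else rank γ M)) (≢⇒≡ᵇ-false (>⇒≢ M∈γ)) ⟩
  allᵇ (rank γ) (remove M γ) ∧ rank γ M
    ≡⟨ cong₂ _∧_ (allᵇ-cong (λ {a} a≤M → cong (λ c → a ≡ᵇ suc c) (countLess-remove M γ a≤M)) (All-remove M γ γ≤M))
                 (cong (λ c → M ≡ᵇ suc c) (countLess-max M γ γ≤M)) ⟩
  allᵇ (rank (remove M γ)) (remove M γ) ∧ (M ≡ᵇ suc (length (remove M γ))) ∎
  where
  open ≡-Reasoning
  rank : List ℕ → ℕ → Bool
  rank α a = a ≡ᵇ suc (countLess α a)

-- Parking

countLess+multiplicity-mono : ∀ α {c a} → c < a → countLess α c + multiplicity c α ≤ countLess α a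
countLess+multiplicity-mono []      c<a = z≤n
countLess+multiplicity-mono (x ∷ α) {c} {a} c<a with <-cmp x c
... | tri< x<c _ _ rewrite <⇒<ᵇ-true x<c | ≢⇒≡ᵇ-false (>⇒≢ x<c) | <⇒<ᵇ-true (<-trans x<c c<a) =
  s≤s (countLess+multiplicity-mono α c<a)
... | tri≈ _ refl _ rewrite ≤⇒<ᵇ-false (≤-refl {x}) | ≡ᵇ-refl x | <⇒<ᵇ-true c<a =
  subst (_≤ suc (countLess α a)) (sym (+-suc _ _)) (s≤s (countLess+multiplicity-mono α c<a))
... | tri> _ _ c<x rewrite ≤⇒<ᵇ-false (<⇒≤ c<x) | ≢⇒≡ᵇ-false (<⇒≢ c<x) =
  ≤-trans (countLess+multiplicity-mono α c<a) (m≤n+m _ _)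

countLess+multiplicity≤length : ∀ α a → countLess α a + multiplicity a α ≤ length α
countLess+multiplicity≤length []      a = z≤n
countLess+multiplicity≤length (x ∷ α) a with <-cmp x a
... | tri< x<a _ _ rewrite <⇒<ᵇ-true x<a | ≢⇒≡ᵇ-false (>⇒≢ x<a) = s≤s (countLess+multiplicity≤length α a)
... | tri≈ _ refl _ rewrite ≤⇒<ᵇ-false (≤-refl {x}) | ≡ᵇ-refl x =
  subst (_≤ suc (length α)) (sym (+-suc _ _)) (s≤s (countLess+multiplicity≤length α x))
... | tri> _ _ a<x rewrite ≤⇒<ᵇ-false (<⇒≤ a<x) | ≢⇒≡ᵇ-false (<⇒≢ a<x) =
  m≤n⇒m≤1+n (countLess+multiplicity≤length α a)

IsFubini : List ℕ → Set
IsFubini α = ∀ {b} → 0 < multiplicity b α → b ≡ suc (countLess α b)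

allᵇ-occurrence : ∀ p α {b} → allᵇ p α ≡ true → 0 < multiplicity b α → p b ≡ true
allᵇ-occurrence p (x ∷ α) {b} all-p b∈α with b ≟ x
... | yes refl = ∧-conicalˡ (p b) _ all-p
... | no b≢x rewrite ≢⇒≡ᵇ-false b≢x = allᵇ-occurrence p α (∧-conicalʳ (p x) _ all-p) b∈α

isFubiniᵇ⇒IsFubini : ∀ α → isFubiniᵇ α ≡ true → IsFubini α
isFubiniᵇ⇒IsFubini α fub b∈α = ≡ᵇ-true⇒≡ (allᵇ-occurrence _ α fub b∈α)

memberᵇ-cons : ∀ s x xs → memberᵇ s xs ≡ true → memberᵇ s (x ∷ xs) ≡ true
memberᵇ-cons s x xs s∈xs with s ≡ᵇ x
... | true  = refl
... | false = s∈xs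

-- If α is Fubini, every value b occupies the block of spots b, b+1, …, b + multiplicity b α − 1;
-- spots R lists the occupied spots once the cars of R (latest first) have parked.
spots : List ℕ → List ℕ
spots []      = []
spots (b ∷ R) = (b + multiplicity b R) ∷ spots R

length-spots : ∀ R → length (spots R) ≡ length R
length-spots []      = refl
length-spots (b ∷ R) = cong suc (length-spots R)

memberᵇ-spots : ∀ R a {t} → t < multiplicity a R → memberᵇ (a + t) (spots R) ≡ true
memberᵇ-spots (b ∷ R) a {t} t<m with a ≟ b
... | no a≢b rewrite ≢⇒≡ᵇ-false a≢b = memberᵇ-cons _ _ (spots R) (memberᵇ-spots R a t<m)
... | yes refl rewrite ≡ᵇ-refl a with m≤n⇒m<n∨m≡n (m<1+n⇒m≤n t<m)
...   | inj₁ t<m′  = memberᵇ-cons _ _ (spots R) (memberᵇ-spots R a t<m′)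
...   | inj₂ refl rewrite ≡ᵇ-refl (a + multiplicity a R) = refl

memberᵇ-spots⁻ : ∀ R s → memberᵇ s (spots R) ≡ true → ∃[ c ] c ≤ s × s < c + multiplicity c R
memberᵇ-spots⁻ (b ∷ R) s s∈ with s ≡ᵇ b + multiplicity b R in eq
... | true = b , ≤-trans (m≤m+n b _) (≤-reflexive (sym s≡)) , (begin-strict
  s                              ≡⟨ s≡ ⟩
  b + multiplicity b R           <⟨ +-monoʳ-< b (n<1+n _) ⟩
  b + suc (multiplicity b R)     ≡⟨ cong (b +_) (multiplicity-here b R) ⟨
  b + multiplicity b (b ∷ R)     ∎)
  where
  open ≤-Reasoning
  s≡ : s ≡ b + multiplicity b R
  s≡ = ≡ᵇ-true⇒≡ eq
... | false with memberᵇ-spots⁻ R s s∈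
...   | c , c≤s , s<c+m = c , c≤s , <-≤-trans s<c+m (+-monoʳ-≤ c (multiplicity-cons-≤ c b R))

firstFree-after-block : ∀ f occ a p → (∀ {t} → t < p → memberᵇ (a + t) occ ≡ true) →
                        memberᵇ (a + p) occ ≡ false → p ≤ f → firstFree (suc f) occ a ≡ a + p
firstFree-after-block f occ a zero block free _ rewrite +-identityʳ a | free = refl
firstFree-after-block (suc f) occ a (suc p) block free (s≤s p≤f)
  rewrite subst (λ s → memberᵇ s occ ≡ true) (+-identityʳ a) (block (s≤s z≤n)) = begin
  firstFree (suc f) occ (suc a) ≡⟨ firstFree-after-block f occ (suc a) p block′ (subst (λ s → memberᵇ s occ ≡ false) (+-suc a p) free) p≤f ⟩
  suc a + p                     ≡⟨ +-suc a p ⟨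
  a + suc p                     ∎
  where
  open ≡-Reasoning
  block′ : ∀ {t} → t < p → memberᵇ (suc a + t) occ ≡ true
  block′ {t} t<p = subst (λ s → memberᵇ s occ ≡ true) (+-suc a t) (block (s≤s t<p))

multiplicity-shift : ∀ v a R rest → multiplicity v (a ∷ R) + multiplicity v rest ≡ multiplicity v R + multiplicity v (a ∷ rest)
multiplicity-shift v a R rest with v ≡ᵇ a
... | true  = sym (+-suc _ _)
... | false = refl

module Parking (α : List ℕ) (fubini : IsFubini α) where

  N : ℕ
  N = length α

  block-before : ∀ {c a} → c < a → 0 < multiplicity c α → 0 < multiplicity a α → c + multiplicity c α ≤ a
  block-before {c} {a} c<a c∈α a∈α = begin
    c + multiplicity c α                       ≡⟨ cong (_+ multiplicity c α) (fubini c∈α) ⟩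
    suc (countLess α c + multiplicity c α)     ≤⟨ s≤s (countLess+multiplicity-mono α c<a) ⟩
    suc (countLess α a)                        ≡⟨ fubini a∈α ⟨
    a                                          ∎
    where open ≤-Reasoning

  block-end : ∀ {a} → 0 < multiplicity a α → a + multiplicity a α ≤ suc N
  block-end {a} a∈α = begin
    a + multiplicity a α                       ≡⟨ cong (_+ multiplicity a α) (fubini a∈α) ⟩
    suc (countLess α a + multiplicity a α)     ≤⟨ s≤s (countLess+multiplicity≤length α a) ⟩
    suc N                                      ∎
    where open ≤-Reasoning

  next-in-block-free : ∀ R a → (∀ v → multiplicity v R ≤ multiplicity v α) → multiplicity a R < multiplicity a α →
                       memberᵇ (a + multiplicity a R) (spots R) ≡ false
  next-in-block-free R a R⊆α p<m with memberᵇ (a + multiplicity a R) (spots R) in occupied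
  ... | false = refl
  ... | true with memberᵇ-spots⁻ R _ occupied
  ...   | c , c≤s , s<c+m = contradiction (<-cmp c a) λ
    { (tri< c<a _ _) → <⇒≱ s<c+m (begin
        c + multiplicity c R  ≤⟨ +-monoʳ-≤ c (R⊆α c) ⟩
        c + multiplicity c α  ≤⟨ block-before c<a c∈α a∈α ⟩
        a                     ≤⟨ m≤m+n a _ ⟩
        a + p                 ∎)
    ; (tri≈ _ refl _) → <-irrefl refl s<c+m
    ; (tri> _ _ a<c) → <⇒≱ (<-≤-trans (+-monoʳ-< a p<m) (block-before a<c a∈α c∈α)) c≤s
    }
    where
    open ≤-Reasoning
    p : ℕ
    p = multiplicity a R
    a∈α : 0 < multiplicity a α
    a∈α = ≤-<-trans z≤n p<m
    c∈α : 0 < multiplicity c α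
    c∈α = <-≤-trans (m≤n<m+o⇒0<o c≤s s<c+m) (R⊆α c)

  parks-next-in-block : ∀ R a rest → (∀ v → multiplicity v R ≤ multiplicity v α) → multiplicity a R < multiplicity a α →
                        luckyGo N (spots R) (a ∷ rest) ≡
                        (if multiplicity a R ≡ᵇ 0 then 1 else 0) + luckyGo N (spots (a ∷ R)) rest
  parks-next-in-block R a rest R⊆α p<m
    rewrite firstFree-after-block (length (spots R)) (spots R) a (multiplicity a R) (memberᵇ-spots R a)
                                  (next-in-block-free R a R⊆α p<m)
                                  (subst (multiplicity a R ≤_) (sym (length-spots R)) (multiplicity≤length a R))
          | ≤⇒≤ᵇ-true (m<1+n⇒m≤n (<-≤-trans (+-monoʳ-< a p<m) (block-end (≤-<-trans z≤n p<m))))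
          | [m+n≡ᵇm]≡[n≡ᵇ0] a (multiplicity a R)
    = refl

  park : ∀ R rest → (∀ v → multiplicity v R + multiplicity v rest ≡ multiplicity v α) →
         luckyGo N (spots R) rest ≡ freshCount R rest
  park R []         _     = refl
  park R (a ∷ rest) split = trans (parks-next-in-block R a rest R⊆α p<m)
                                  (cong (_ +_) (park (a ∷ R) rest (λ v → trans (multiplicity-shift v a R rest) (split v))))
    where
    R⊆α : ∀ v → multiplicity v R ≤ multiplicity v α
    R⊆α v = subst (multiplicity v R ≤_) (split v) (m≤m+n _ _)
    p<m : multiplicity a R < multiplicity a α
    p<m = subst (multiplicity a R <_) (split a) (m<m+n _ (multiplicity-here>0 a rest))

luckyCount≡distinctCount : ∀ α → isFubiniᵇ α ≡ true → luckyCount (length α) α ≡ distinctCount α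
luckyCount≡distinctCount α fub = Parking.park α (isFubiniᵇ⇒IsFubini α fub) [] α (λ _ → refl)

-- Counting Fubini rankings

fubiniIndicator : ℕ → List ℕ → ℕ
fubiniIndicator k γ = if isFubiniᵇ γ then (if distinctCount γ ≡ᵇ k then 1 else 0) else 0

fubiniCount : ℕ → ℕ → ℕ → ℕ
fubiniCount m n k = sumOver (fubiniIndicator k) (tuples m n)

fFR≡fubiniCount : ∀ n k → fFR n k ≡ fubiniCount n n k
fFR≡fubiniCount n k = begin
  length (filter lucky? fubini)                      ≡⟨ length≡sumOver-1 (filter lucky? fubini) ⟩
  sumOver (λ _ → 1) (filter lucky? fubini)           ≡⟨ sumOver-filter lucky? (λ _ → 1) fubini ⟩
  sumOver (λ α → if luckyCount n α ≡ᵇ k then 1 else 0) fubini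
    ≡⟨ sumOver-filter (T? ∘ isFubiniᵇ) _ (tuples n n) ⟩
  sumOver (λ α → if isFubiniᵇ α then (if luckyCount n α ≡ᵇ k then 1 else 0) else 0) (tuples n n)
    ≡⟨ sumOver-tuples-cong n n lucky≡distinct ⟩
  fubiniCount n n k ∎
  where
  open ≡-Reasoning
  lucky? : Decidable (λ α → luckyCount n α ≡ k)
  lucky? α = luckyCount n α ≟ k
  fubini : List (List ℕ)
  fubini = filter (T? ∘ isFubiniᵇ) (tuples n n)
  lucky≡distinct : ∀ α → length α ≡ n → All (_≤ n) α →
                   (if isFubiniᵇ α then (if luckyCount n α ≡ᵇ k then 1 else 0) else 0) ≡ fubiniIndicator k α
  lucky≡distinct α refl _ with isFubiniᵇ α in fub
  ... | true  rewrite luckyCount≡distinctCount α fub = refl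
  ... | false = refl

afterRemovingMax : ℕ → ℕ → ℕ → List ℕ → ℕ
afterRemovingMax m k zero    β = fubiniIndicator (suc k) β
afterRemovingMax m k (suc _) β = if m ≡ᵇ length β then fubiniIndicator k β else 0

fubiniIndicator-remove-max : ∀ m k γ → All (_≤ suc m) γ → 0 < multiplicity (suc m) γ →
  fubiniIndicator (suc k) γ ≡ (if m ≡ᵇ length (remove (suc m) γ) then fubiniIndicator k (remove (suc m) γ) else 0)
fubiniIndicator-remove-max m k γ γ≤ M∈γ
  rewrite isFubiniᵇ-remove-max (suc m) γ γ≤ M∈γ | freshCount-remove-unseen (suc m) [] γ refl M∈γ =
  if-∧ (isFubiniᵇ (remove (suc m) γ)) (m ≡ᵇ length (remove (suc m) γ))
  where
  if-∧ : ∀ x y {v : ℕ} → (if x ∧ y then v else 0) ≡ (if y then (if x then v else 0) else 0)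
  if-∧ true  y     = refl
  if-∧ false true  = refl
  if-∧ false false = refl

fubiniIndicator-split : ∀ m k γ → All (_≤ suc m) γ →
  fubiniIndicator (suc k) γ ≡ afterRemovingMax m k (multiplicity (suc m) γ) (remove (suc m) γ)
fubiniIndicator-split m k γ γ≤ with multiplicity (suc m) γ in mult
... | zero  = cong (fubiniIndicator (suc k)) (sym (remove-multiplicity≡0 (suc m) γ mult))
... | suc j = fubiniIndicator-remove-max m k γ γ≤ (subst (0 <_) (sym mult) (s≤s z≤n))

fubiniCount-suc-alphabet : ∀ {m n} k → m < n →
  fubiniCount (suc m) n (suc k) ≡ fubiniCount m n (suc k) + (n C m) * fubiniCount m m k
fubiniCount-suc-alphabet {m} {n} k m<n = begin
  sumOver (fubiniIndicator (suc k)) (tuples (suc m) n)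
    ≡⟨ sumOver-tuples-cong (suc m) n (λ γ _ γ≤ → fubiniIndicator-split m k γ γ≤) ⟩
  sumOver (λ γ → h (multiplicity (suc m) γ) (remove (suc m) γ)) (tuples (suc m) n)
    ≡⟨ sumOver-tuples-binomial m n h ⟩
  Σ< (suc n) (λ i → (n C i) * sumOver (h (n ∸ i)) (tuples m i))
    ≡⟨ Σ<-suc n _ ⟩
  Σ< n (λ i → (n C i) * sumOver (h (n ∸ i)) (tuples m i)) + (n C n) * sumOver (h (n ∸ n)) (tuples m n)
    ≡⟨ cong₂ _+_ (Σ<-cong n term) (cong₂ (λ c d → c * sumOver (h d) (tuples m n)) (nCn≡1 n) (n∸n≡0 n)) ⟩
  Σ< n (λ i → if m ≡ᵇ i then (n C i) * fubiniCount m i k else 0) + 1 * fubiniCount m n (suc k)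
    ≡⟨ cong₂ _+_ (Σ<-indicator (λ i → (n C i) * fubiniCount m i k) m<n) (*-identityˡ _) ⟩
  (n C m) * fubiniCount m m k + fubiniCount m n (suc k)
    ≡⟨ +-comm ((n C m) * fubiniCount m m k) _ ⟩
  fubiniCount m n (suc k) + (n C m) * fubiniCount m m k ∎
  where
  open ≡-Reasoning
  h : ℕ → List ℕ → ℕ
  h = afterRemovingMax m k
  pull : ∀ i b → (n C i) * sumOver (λ β → if b then fubiniIndicator k β else 0) (tuples m i) ≡
                 (if b then (n C i) * fubiniCount m i k else 0)
  pull i true  = refl
  pull i false = trans (cong ((n C i) *_) (sumOver-zero (tuples m i))) (*-zeroʳ (n C i))
  term : ∀ {i} → i < n → (n C i) * sumOver (h (n ∸ i)) (tuples m i) ≡ (if m ≡ᵇ i then (n C i) * fubiniCount m i k else 0)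
  term {i} i<n = begin
    (n C i) * sumOver (h (n ∸ i)) (tuples m i)
      ≡⟨ cong (λ d → (n C i) * sumOver (h d) (tuples m i)) (m<n⇒n∸m≡1+[n∸1+m] i<n) ⟩
    (n C i) * sumOver (λ β → if m ≡ᵇ length β then fubiniIndicator k β else 0) (tuples m i)
      ≡⟨ cong ((n C i) *_) (sumOver-tuples-cong m i (λ β |β|≡i _ → cong (λ l → if m ≡ᵇ l then fubiniIndicator k β else 0) |β|≡i)) ⟩
    (n C i) * sumOver (λ β → if m ≡ᵇ i then fubiniIndicator k β else 0) (tuples m i)
      ≡⟨ pull i (m ≡ᵇ i) ⟩
    (if m ≡ᵇ i then (n C i) * fubiniCount m i k else 0) ∎

fubiniCount-unroll : ∀ {M n} k → M ≤ n →
  fubiniCount M n (suc k) ≡ fubiniCount 0 n (suc k) + Σ< M (λ m → (n C m) * fubiniCount m m k)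
fubiniCount-unroll {zero}  {n} k _   = sym (+-identityʳ _)
fubiniCount-unroll {suc M} {n} k M<n = begin
  fubiniCount (suc M) n (suc k)
    ≡⟨ fubiniCount-suc-alphabet k M<n ⟩
  fubiniCount M n (suc k) + (n C M) * fubiniCount M M k
    ≡⟨ cong (_+ (n C M) * fubiniCount M M k) (fubiniCount-unroll k (<⇒≤ M<n)) ⟩
  fubiniCount 0 n (suc k) + Σ< M (λ m → (n C m) * fubiniCount m m k) + (n C M) * fubiniCount M M k
    ≡⟨ +-assoc (fubiniCount 0 n (suc k)) _ _ ⟩
  fubiniCount 0 n (suc k) + (Σ< M (λ m → (n C m) * fubiniCount m m k) + (n C M) * fubiniCount M M k)
    ≡⟨ cong (fubiniCount 0 n (suc k) +_) (Σ<-suc M _) ⟨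
  fubiniCount 0 n (suc k) + Σ< (suc M) (λ m → (n C m) * fubiniCount m m k) ∎
  where open ≡-Reasoning

fubiniCount-empty-alphabet : ∀ n k → fubiniCount 0 n (suc k) ≡ 0
fubiniCount-empty-alphabet zero    k = refl
fubiniCount-empty-alphabet (suc n) k = refl

fFR-suc : ∀ n k → fFR n (suc k) ≡ Σ< n (λ m → (n C m) * fFR m k)
fFR-suc n k = begin
  fFR n (suc k)                                                       ≡⟨ fFR≡fubiniCount n (suc k) ⟩
  fubiniCount n n (suc k)                                             ≡⟨ fubiniCount-unroll {n} k ≤-refl ⟩
  fubiniCount 0 n (suc k) + Σ< n (λ m → (n C m) * fubiniCount m m k)  ≡⟨ cong (_+ Σ< n (λ m → (n C m) * fubiniCount m m k)) (fubiniCount-empty-alphabet n k) ⟩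
  Σ< n (λ m → (n C m) * fubiniCount m m k)                            ≡⟨ Σ<-cong n (λ {m} _ → cong ((n C m) *_) (fFR≡fubiniCount m k)) ⟨
  Σ< n (λ m → (n C m) * fFR m k)                                      ∎
  where open ≡-Reasoning

fFR-zero : ∀ n → fFR (suc n) 0 ≡ 0
fFR-zero n = trans (fFR≡fubiniCount (suc n) 0)
                   (trans (sumOver-tuples-cong (suc n) (suc n) no-empty-ranking) (sumOver-zero (tuples (suc n) (suc n))))
  where
  no-empty-ranking : ∀ γ → length γ ≡ suc n → All (_≤ suc n) γ → fubiniIndicator 0 γ ≡ 0
  no-empty-ranking (a ∷ γ) _ _ with isFubiniᵇ (a ∷ γ)
  ... | true  = refl
  ... | false = refl

-- Generating functions

fromℕ : ℕ → ℚ
fromℕ n = ℤ.+ n / 1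

-- Identities in ℚ are proved on unnormalised representatives, where i / suc d is just mkℚᵘ i d.
toℚᵘ-/ : ∀ i d → toℚᵘ (i / suc d) ≃ᵘ mkℚᵘ i d
toℚᵘ-/ i d = toℚᵘ-fromℚᵘ (mkℚᵘ i d)

fromℕ-+ : ∀ a b → fromℕ (a + b) ≡ fromℕ a ℚ.+ fromℕ b
fromℕ-+ a b = toℚᵘ-injective (begin
  toℚᵘ (fromℕ (a + b))                  ≈⟨ toℚᵘ-/ (ℤ.+ (a + b)) 0 ⟩
  mkℚᵘ (ℤ.+ (a + b)) 0                  ≈⟨ *≡* (cong (ℤ._* ℤ.+ 1) (trans (ℤₚ.pos-+ a b) (sym +a*1++b*1≡+a++b))) ⟩
  mkℚᵘ (ℤ.+ a) 0 ℚᵘ.+ mkℚᵘ (ℤ.+ b) 0    ≈⟨ ℚᵘₚ.+-cong (toℚᵘ-/ (ℤ.+ a) 0) (toℚᵘ-/ (ℤ.+ b) 0) ⟨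
  toℚᵘ (fromℕ a) ℚᵘ.+ toℚᵘ (fromℕ b)    ≈⟨ toℚᵘ-homo-+ (fromℕ a) (fromℕ b) ⟨
  toℚᵘ (fromℕ a ℚ.+ fromℕ b)            ∎)
  where
  open ℚᵘₚ.≃-Reasoning
  +a*1++b*1≡+a++b : ℤ.+ a ℤ.* ℤ.+ 1 ℤ.+ ℤ.+ b ℤ.* ℤ.+ 1 ≡ ℤ.+ a ℤ.+ ℤ.+ b
  +a*1++b*1≡+a++b = cong₂ ℤ._+_ (ℤₚ.*-identityʳ (ℤ.+ a)) (ℤₚ.*-identityʳ (ℤ.+ b))

fromℕ-* : ∀ a b → fromℕ (a * b) ≡ fromℕ a ℚ.* fromℕ b
fromℕ-* a b = toℚᵘ-injective (begin
  toℚᵘ (fromℕ (a * b))                  ≈⟨ toℚᵘ-/ (ℤ.+ (a * b)) 0 ⟩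
  mkℚᵘ (ℤ.+ (a * b)) 0                  ≈⟨ *≡* (cong (ℤ._* ℤ.+ 1) (ℤₚ.pos-* a b)) ⟩
  mkℚᵘ (ℤ.+ a) 0 ℚᵘ.* mkℚᵘ (ℤ.+ b) 0    ≈⟨ ℚᵘₚ.*-cong (toℚᵘ-/ (ℤ.+ a) 0) (toℚᵘ-/ (ℤ.+ b) 0) ⟨
  toℚᵘ (fromℕ a) ℚᵘ.* toℚᵘ (fromℕ b)    ≈⟨ toℚᵘ-homo-* (fromℕ a) (fromℕ b) ⟨
  toℚᵘ (fromℕ a ℚ.* fromℕ b)            ∎)
  where open ℚᵘₚ.≃-Reasoning

n/d≡fromℕ[n]*1/d : ∀ n d .{{_ : NonZero d}} → ℤ.+ n / d ≡ fromℕ n ℚ.* (ℤ.+ 1 / d)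
n/d≡fromℕ[n]*1/d n (suc d) = toℚᵘ-injective (begin
  toℚᵘ (ℤ.+ n / suc d)                     ≈⟨ toℚᵘ-/ (ℤ.+ n) d ⟩
  mkℚᵘ (ℤ.+ n) d                           ≈⟨ *≡* (ℤₚ.*-assoc (ℤ.+ n) (ℤ.+ 1) (ℤ.+ suc d)) ⟨
  mkℚᵘ (ℤ.+ n) 0 ℚᵘ.* mkℚᵘ (ℤ.+ 1) d       ≈⟨ ℚᵘₚ.*-cong (toℚᵘ-/ (ℤ.+ n) 0) (toℚᵘ-/ (ℤ.+ 1) d) ⟨
  toℚᵘ (fromℕ n) ℚᵘ.* toℚᵘ (ℤ.+ 1 / suc d) ≈⟨ toℚᵘ-homo-* (fromℕ n) (ℤ.+ 1 / suc d) ⟨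
  toℚᵘ (fromℕ n ℚ.* (ℤ.+ 1 / suc d))       ∎)
  where open ℚᵘₚ.≃-Reasoning

fromℕ[d]*1/d≡1 : ∀ d .{{_ : NonZero d}} → fromℕ d ℚ.* (ℤ.+ 1 / d) ≡ 1ℚ
fromℕ[d]*1/d≡1 (suc d) = begin
  fromℕ (suc d) ℚ.* (ℤ.+ 1 / suc d)   ≡⟨ n/d≡fromℕ[n]*1/d (suc d) (suc d) ⟨
  ℤ.+ suc d / suc d                   ≡⟨ toℚᵘ-injective (ℚᵘₚ.≃-trans (toℚᵘ-/ (ℤ.+ suc d) d) (*≡* (ℤₚ.*-comm (ℤ.+ suc d) (ℤ.+ 1)))) ⟩
  1ℚ                                  ∎
  where open ≡-Reasoning

module ℚΣ = RangeSum (CommutativeRing.commutativeSemiring ℚₚ.+-*-commutativeRing)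

fromℕ-Σ< : ∀ n (f : ℕ → ℕ) → fromℕ (Σ< n f) ≡ ℚΣ.Σ< n (fromℕ ∘ f)
fromℕ-Σ< zero    f = refl
fromℕ-Σ< (suc n) f = trans (fromℕ-+ (f 0) _) (cong (fromℕ (f 0) ℚ.+_) (fromℕ-Σ< n (f ∘ suc)))

fubiniEGF≡fromℕ*invFact : ∀ n k → fubiniEGF n k ≡ fromℕ (fFR n k) ℚ.* invFact n
fubiniEGF≡fromℕ*invFact n k = n/d≡fromℕ[n]*1/d (fFR n k) (n !) {{n !≢0}}

fromℕ[n!]*invFact≡1 : ∀ n → fromℕ (n !) ℚ.* invFact n ≡ 1ℚ
fromℕ[n!]*invFact≡1 n = fromℕ[d]*1/d≡1 (n !) {{n !≢0}}

binomial*factorials : ∀ {m n} → m ≤ n → (n C m) * (m ! * (n ∸ m) !) ≡ n !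
binomial*factorials {m} {n} m≤n =
  trans (cong (_* (m ! * (n ∸ m) !)) (nCk≡n!/k![n-k]! m≤n)) (m/n*n≡m (k![n∸k]!∣n! m≤n))
  where instance _ = m !* (n ∸ m) !≢0

binomial*invFact : ∀ {m n} → m ≤ n → fromℕ (n C m) ℚ.* invFact n ≡ invFact m ℚ.* invFact (n ∸ m)
binomial*invFact {m} {n} m≤n = begin
  c ℚ.* iN                                 ≡⟨ trans (ℚₚ.*-identityʳ _) (ℚₚ.*-identityʳ _) ⟨
  c ℚ.* iN ℚ.* 1ℚ ℚ.* 1ℚ                   ≡⟨ cong₂ (λ x y → c ℚ.* iN ℚ.* x ℚ.* y) (fromℕ[n!]*invFact≡1 m) (fromℕ[n!]*invFact≡1 (n ∸ m)) ⟨
  c ℚ.* iN ℚ.* (a ℚ.* iA) ℚ.* (b ℚ.* iB)   ≡⟨ solve 6 (λ c iN a iA b iB → c :* iN :* (a :* iA) :* (b :* iB) := c :* (a :* b) :* iN :* (iA :* iB))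
                                                      refl c iN a iA b iB ⟩
  c ℚ.* (a ℚ.* b) ℚ.* iN ℚ.* (iA ℚ.* iB)   ≡⟨ cong (λ x → x ℚ.* iN ℚ.* (iA ℚ.* iB)) n!≡c*a*b ⟨
  fromℕ (n !) ℚ.* iN ℚ.* (iA ℚ.* iB)       ≡⟨ cong (ℚ._* (iA ℚ.* iB)) (fromℕ[n!]*invFact≡1 n) ⟩
  1ℚ ℚ.* (iA ℚ.* iB)                       ≡⟨ ℚₚ.*-identityˡ (iA ℚ.* iB) ⟩
  iA ℚ.* iB                                ∎
  where
  open ≡-Reasoning
  open +-*-Solver
  c a b iN iA iB : ℚ
  c = fromℕ (n C m); a = fromℕ (m !); b = fromℕ ((n ∸ m) !)
  iN = invFact n; iA = invFact m; iB = invFact (n ∸ m)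
  n!≡c*a*b : fromℕ (n !) ≡ c ℚ.* (a ℚ.* b)
  n!≡c*a*b = begin
    fromℕ (n !)                              ≡⟨ cong fromℕ (binomial*factorials m≤n) ⟨
    fromℕ ((n C m) * (m ! * (n ∸ m) !))      ≡⟨ fromℕ-* (n C m) _ ⟩
    c ℚ.* fromℕ (m ! * (n ∸ m) !)            ≡⟨ cong (c ℚ.*_) (fromℕ-* (m !) _) ⟩
    c ℚ.* (a ℚ.* b)                          ∎

fubiniEGF-suc : ∀ n k → fubiniEGF n (suc k) ≡ ℚΣ.Σ< n (λ i → fubiniEGF i k ℚ.* invFact (n ∸ i))
fubiniEGF-suc n k = begin
  fubiniEGF n (suc k)                                          ≡⟨ fubiniEGF≡fromℕ*invFact n (suc k) ⟩
  fromℕ (fFR n (suc k)) ℚ.* invFact n                          ≡⟨ cong (λ x → fromℕ x ℚ.* invFact n) (fFR-suc n k) ⟩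
  fromℕ (Σ< n (λ m → (n C m) * fFR m k)) ℚ.* invFact n         ≡⟨ cong (ℚ._* invFact n) (fromℕ-Σ< n _) ⟩
  ℚΣ.Σ< n (λ m → fromℕ ((n C m) * fFR m k)) ℚ.* invFact n      ≡⟨ ℚΣ.Σ<-*ʳ n _ (invFact n) ⟩
  ℚΣ.Σ< n (λ m → fromℕ ((n C m) * fFR m k) ℚ.* invFact n)      ≡⟨ ℚΣ.Σ<-cong n (term ∘ <⇒≤) ⟩
  ℚΣ.Σ< n (λ m → fubiniEGF m k ℚ.* invFact (n ∸ m))            ∎
  where
  open ≡-Reasoning
  open +-*-Solver
  term : ∀ {m} → m ≤ n → fromℕ ((n C m) * fFR m k) ℚ.* invFact n ≡ fubiniEGF m k ℚ.* invFact (n ∸ m)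
  term {m} m≤n = begin
    fromℕ ((n C m) * fFR m k) ℚ.* invFact n                ≡⟨ cong (ℚ._* invFact n) (fromℕ-* (n C m) (fFR m k)) ⟩
    fromℕ (n C m) ℚ.* fromℕ (fFR m k) ℚ.* invFact n        ≡⟨ solve 3 (λ c f iN → c :* f :* iN := f :* (c :* iN)) refl
                                                                     (fromℕ (n C m)) (fromℕ (fFR m k)) (invFact n) ⟩
    fromℕ (fFR m k) ℚ.* (fromℕ (n C m) ℚ.* invFact n)      ≡⟨ cong (fromℕ (fFR m k) ℚ.*_) (binomial*invFact m≤n) ⟩
    fromℕ (fFR m k) ℚ.* (invFact m ℚ.* invFact (n ∸ m))    ≡⟨ ℚₚ.*-assoc (fromℕ (fFR m k)) _ _ ⟨
    fromℕ (fFR m k) ℚ.* invFact m ℚ.* invFact (n ∸ m)      ≡⟨ cong (ℚ._* invFact (n ∸ m)) (fubiniEGF≡fromℕ*invFact m k) ⟨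
    fubiniEGF m k ℚ.* invFact (n ∸ m)                      ∎

fubiniEGF-zero : ∀ n → fubiniEGF n 0 ≡ one n 0
fubiniEGF-zero zero    = refl
fubiniEGF-zero (suc n) =
  trans (cong (λ x → (ℤ.+ x / suc n !) {{suc n !≢0}}) (fFR-zero n)) (ℚₚ.0/n≡0 (suc n !) {{suc n !≢0}})

sumTo≡Σ< : ∀ n (f : ℕ → ℚ) → sumTo n f ≡ ℚΣ.Σ< (suc n) f
sumTo≡Σ< n f = foldr-applyUpTo id (suc n)
  where
  foldr-applyUpTo : ∀ g m → foldr (λ i acc → f i ℚ.+ acc) 0ℚ (applyUpTo g m) ≡ ℚΣ.Σ< m (f ∘ g)
  foldr-applyUpTo g zero    = refl
  foldr-applyUpTo g (suc m) = cong (f (g 0) ℚ.+_) (foldr-applyUpTo (g ∘ suc) m)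

Σ<-neg : ∀ n (f : ℕ → ℚ) → ℚΣ.Σ< n (λ i → ℚ.- f i) ≡ ℚ.- ℚΣ.Σ< n f
Σ<-neg zero    f = refl
Σ<-neg (suc n) f = trans (cong (ℚ.- f 0 ℚ.+_) (Σ<-neg n (f ∘ suc))) (sym (ℚₚ.neg-distrib-+ (f 0) _))

one-suc : ∀ n k → one n (suc k) ≡ 0ℚ
one-suc zero    k = refl
one-suc (suc n) k = refl

Σ<-*one : ∀ n (f : ℕ → ℚ) → ℚΣ.Σ< (suc n) (λ i → f i ℚ.* one (n ∸ i) 0) ≡ f n
Σ<-*one n f = begin
  ℚΣ.Σ< (suc n) (λ i → f i ℚ.* one (n ∸ i) 0)                        ≡⟨ ℚΣ.Σ<-suc n (λ i → f i ℚ.* one (n ∸ i) 0) ⟩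
  ℚΣ.Σ< n (λ i → f i ℚ.* one (n ∸ i) 0) ℚ.+ f n ℚ.* one (n ∸ n) 0    ≡⟨ cong₂ ℚ._+_ (ℚΣ.Σ<-zero n vanish) (cong (λ d → f n ℚ.* one d 0) (n∸n≡0 n)) ⟩
  0ℚ ℚ.+ f n ℚ.* 1ℚ                                                  ≡⟨ trans (ℚₚ.+-identityˡ (f n ℚ.* 1ℚ)) (ℚₚ.*-identityʳ (f n)) ⟩
  f n                                                                ∎
  where
  open ≡-Reasoning
  vanish : ∀ {i} → i < n → f i ℚ.* one (n ∸ i) 0 ≡ 0ℚ
  vanish {i} i<n = trans (cong (λ d → f i ℚ.* one d 0) (m<n⇒n∸m≡1+[n∸1+m] i<n)) (ℚₚ.*-zeroʳ (f i))

⊛-q-constˡ : ∀ (F G : FPS₂) n k → (∀ i j → F i (suc j) ≡ 0ℚ) →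
             (F ⊛ G) n k ≡ ℚΣ.Σ< (suc n) (λ i → F i 0 ℚ.* G (n ∸ i) k)
⊛-q-constˡ F G n k F-const = trans (sumTo≡Σ< n (λ i → sumTo k (g i))) (ℚΣ.Σ<-cong (suc n) (λ {i} _ → inner i))
  where
  g : ℕ → ℕ → ℚ
  g i j = F i j ℚ.* G (n ∸ i) (k ∸ j)
  inner : ∀ i → sumTo k (g i) ≡ F i 0 ℚ.* G (n ∸ i) k
  inner i = begin
    sumTo k (g i)                                           ≡⟨ sumTo≡Σ< k (g i) ⟩
    g i 0 ℚ.+ ℚΣ.Σ< k (g i ∘ suc)                           ≡⟨ cong (g i 0 ℚ.+_) (ℚΣ.Σ<-zero k (λ {j} _ → positive-degree j)) ⟩
    g i 0 ℚ.+ 0ℚ                                            ≡⟨ ℚₚ.+-identityʳ (g i 0) ⟩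
    F i 0 ℚ.* G (n ∸ i) k                                   ∎
    where
    open ≡-Reasoning
    positive-degree : ∀ j → g i (suc j) ≡ 0ℚ
    positive-degree j = trans (cong (ℚ._* G (n ∸ i) (k ∸ suc j)) (F-const i j)) (ℚₚ.*-zeroˡ (G (n ∸ i) (k ∸ suc j)))

⊛-q-linearʳ : ∀ (F G : FPS₂) n k → (∀ a d → G a (suc (suc d)) ≡ 0ℚ) →
              (F ⊛ G) n (suc k) ≡ ℚΣ.Σ< (suc n) (λ i → F i (suc k) ℚ.* G (n ∸ i) 0 ℚ.+ F i k ℚ.* G (n ∸ i) 1)
⊛-q-linearʳ F G n k G-linear = trans (sumTo≡Σ< n (λ i → sumTo (suc k) (g i))) (ℚΣ.Σ<-cong (suc n) (λ {i} _ → inner i))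
  where
  g : ℕ → ℕ → ℚ
  g i j = F i j ℚ.* G (n ∸ i) (suc k ∸ j)
  inner : ∀ i → sumTo (suc k) (g i) ≡ F i (suc k) ℚ.* G (n ∸ i) 0 ℚ.+ F i k ℚ.* G (n ∸ i) 1
  inner i = begin
    sumTo (suc k) (g i)                                        ≡⟨ sumTo≡Σ< (suc k) (g i) ⟩
    ℚΣ.Σ< (suc (suc k)) (g i)                                  ≡⟨ ℚΣ.Σ<-suc (suc k) (g i) ⟩
    ℚΣ.Σ< (suc k) (g i) ℚ.+ g i (suc k)                        ≡⟨ cong (ℚ._+ g i (suc k)) (ℚΣ.Σ<-suc k (g i)) ⟩
    ℚΣ.Σ< k (g i) ℚ.+ g i k ℚ.+ g i (suc k)                    ≡⟨ cong (λ x → x ℚ.+ g i k ℚ.+ g i (suc k)) (ℚΣ.Σ<-zero k high-degree) ⟩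
    0ℚ ℚ.+ g i k ℚ.+ g i (suc k)                               ≡⟨ cong (ℚ._+ g i (suc k)) (ℚₚ.+-identityˡ (g i k)) ⟩
    g i k ℚ.+ g i (suc k)                                      ≡⟨ ℚₚ.+-comm (g i k) (g i (suc k)) ⟩
    g i (suc k) ℚ.+ g i k                                      ≡⟨ cong₂ (λ d e → F i (suc k) ℚ.* G (n ∸ i) d ℚ.+ F i k ℚ.* G (n ∸ i) e)
                                                                        (n∸n≡0 k) (m+n∸n≡m 1 k) ⟩
    F i (suc k) ℚ.* G (n ∸ i) 0 ℚ.+ F i k ℚ.* G (n ∸ i) 1      ∎
    where
    open ≡-Reasoning
    high-degree : ∀ {j} → j < k → g i j ≡ 0ℚ
    high-degree {j} j<k = begin
      F i j ℚ.* G (n ∸ i) (suc k ∸ j)                 ≡⟨ cong (λ d → F i j ℚ.* G (n ∸ i) d) (m<n⇒n∸m≡1+[n∸1+m] (m<n⇒m<1+n j<k)) ⟩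
      F i j ℚ.* G (n ∸ i) (suc (k ∸ j))               ≡⟨ cong (λ d → F i j ℚ.* G (n ∸ i) (suc d)) (m<n⇒n∸m≡1+[n∸1+m] j<k) ⟩
      F i j ℚ.* G (n ∸ i) (suc (suc (k ∸ suc j)))     ≡⟨ cong (F i j ℚ.*_) (G-linear (n ∸ i) (k ∸ suc j)) ⟩
      F i j ℚ.* 0ℚ                                    ≡⟨ ℚₚ.*-zeroʳ (F i j) ⟩
      0ℚ                                              ∎

qVar-0 : ∀ x → qVar x 0 ≡ 0ℚ
qVar-0 zero    = refl
qVar-0 (suc x) = refl

qVar-1 : ∀ x → qVar x 1 ≡ one x 0
qVar-1 zero    = refl
qVar-1 (suc x) = refl

qVar-2+ : ∀ x d → qVar x (suc (suc d)) ≡ 0ℚ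
qVar-2+ zero    d = refl
qVar-2+ (suc x) d = refl

eˣ-1 : FPS₂
eˣ-1 = expX ⊖ one

eˣ-1-q-const : ∀ i j → eˣ-1 i (suc j) ≡ 0ℚ
eˣ-1-q-const i j = cong (λ x → 0ℚ ℚ.- x) (one-suc i j)

[eˣ-1]q : ∀ a k → (eˣ-1 ⊛ qVar) a k ≡ ℚΣ.Σ< (suc a) (λ i → eˣ-1 i 0 ℚ.* qVar (a ∸ i) k)
[eˣ-1]q a k = ⊛-q-constˡ eˣ-1 qVar a k eˣ-1-q-const

denom-0 : ∀ a → denom a 0 ≡ one a 0
denom-0 a = begin
  one a 0 ℚ.- (eˣ-1 ⊛ qVar) a 0                                  ≡⟨ cong (λ x → one a 0 ℚ.- x) ([eˣ-1]q a 0) ⟩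
  one a 0 ℚ.- ℚΣ.Σ< (suc a) (λ i → eˣ-1 i 0 ℚ.* qVar (a ∸ i) 0)  ≡⟨ cong (λ x → one a 0 ℚ.- x) (ℚΣ.Σ<-zero (suc a) (λ {i} _ → vanish i)) ⟩
  one a 0 ℚ.- 0ℚ                                                 ≡⟨ ℚₚ.+-identityʳ (one a 0) ⟩
  one a 0                                                        ∎
  where
  open ≡-Reasoning
  vanish : ∀ i → eˣ-1 i 0 ℚ.* qVar (a ∸ i) 0 ≡ 0ℚ
  vanish i = trans (cong (eˣ-1 i 0 ℚ.*_) (qVar-0 (a ∸ i))) (ℚₚ.*-zeroʳ (eˣ-1 i 0))

denom-1 : ∀ a → denom a 1 ≡ ℚ.- eˣ-1 a 0
denom-1 a = begin
  one a 1 ℚ.- (eˣ-1 ⊛ qVar) a 1                                  ≡⟨ cong₂ ℚ._-_ (one-suc a 0) ([eˣ-1]q a 1) ⟩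
  0ℚ ℚ.- ℚΣ.Σ< (suc a) (λ i → eˣ-1 i 0 ℚ.* qVar (a ∸ i) 1)       ≡⟨ cong (λ x → 0ℚ ℚ.- x) (ℚΣ.Σ<-cong (suc a) (λ {i} _ → cong (eˣ-1 i 0 ℚ.*_) (qVar-1 (a ∸ i)))) ⟩
  0ℚ ℚ.- ℚΣ.Σ< (suc a) (λ i → eˣ-1 i 0 ℚ.* one (a ∸ i) 0)       ≡⟨ cong (λ x → 0ℚ ℚ.- x) (Σ<-*one a (λ i → eˣ-1 i 0)) ⟩
  0ℚ ℚ.- eˣ-1 a 0                                                ≡⟨ ℚₚ.+-identityˡ (ℚ.- eˣ-1 a 0) ⟩
  ℚ.- eˣ-1 a 0                                                   ∎
  where open ≡-Reasoning

denom-1-pos : ∀ {a} → 0 < a → denom a 1 ≡ ℚ.- invFact a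
denom-1-pos {suc a} _ = trans (denom-1 (suc a)) (cong ℚ.-_ (ℚₚ.+-identityʳ (invFact (suc a))))

denom-2+ : ∀ a d → denom a (suc (suc d)) ≡ 0ℚ
denom-2+ a d = begin
  one a (suc (suc d)) ℚ.- (eˣ-1 ⊛ qVar) a (suc (suc d))                    ≡⟨ cong₂ ℚ._-_ (one-suc a (suc d)) ([eˣ-1]q a (suc (suc d))) ⟩
  0ℚ ℚ.- ℚΣ.Σ< (suc a) (λ i → eˣ-1 i 0 ℚ.* qVar (a ∸ i) (suc (suc d)))     ≡⟨ cong (λ x → 0ℚ ℚ.- x) (ℚΣ.Σ<-zero (suc a) (λ {i} _ → vanish i)) ⟩
  0ℚ ℚ.- 0ℚ                                                                ≡⟨⟩
  0ℚ                                                                       ∎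
  where
  open ≡-Reasoning
  vanish : ∀ i → eˣ-1 i 0 ℚ.* qVar (a ∸ i) (suc (suc d)) ≡ 0ℚ
  vanish i = trans (cong (eˣ-1 i 0 ℚ.*_) (qVar-2+ (a ∸ i) d)) (ℚₚ.*-zeroʳ (eˣ-1 i 0))

⊛-denom-zero : ∀ (F : FPS₂) n → (F ⊛ denom) n 0 ≡ F n 0
⊛-denom-zero F n = begin
  (F ⊛ denom) n 0                                           ≡⟨ sumTo≡Σ< n (λ i → sumTo 0 (λ j → F i j ℚ.* denom (n ∸ i) (0 ∸ j))) ⟩
  ℚΣ.Σ< (suc n) (λ i → F i 0 ℚ.* denom (n ∸ i) 0 ℚ.+ 0ℚ)    ≡⟨ ℚΣ.Σ<-cong (suc n) (λ {i} _ → constant-term i) ⟩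
  ℚΣ.Σ< (suc n) (λ i → F i 0 ℚ.* one (n ∸ i) 0)            ≡⟨ Σ<-*one n (λ i → F i 0) ⟩
  F n 0                                                     ∎
  where
  open ≡-Reasoning
  constant-term : ∀ i → F i 0 ℚ.* denom (n ∸ i) 0 ℚ.+ 0ℚ ≡ F i 0 ℚ.* one (n ∸ i) 0
  constant-term i = trans (ℚₚ.+-identityʳ _) (cong (F i 0 ℚ.*_) (denom-0 (n ∸ i)))

⊛-denom-suc : ∀ (F : FPS₂) n k → (F ⊛ denom) n (suc k) ≡ F n (suc k) ℚ.- ℚΣ.Σ< n (λ i → F i k ℚ.* invFact (n ∸ i))
⊛-denom-suc F n k = begin
  (F ⊛ denom) n (suc k)
    ≡⟨ ⊛-q-linearʳ F denom n k denom-2+ ⟩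
  ℚΣ.Σ< (suc n) (λ i → F i (suc k) ℚ.* denom (n ∸ i) 0 ℚ.+ F i k ℚ.* denom (n ∸ i) 1)
    ≡⟨ ℚΣ.Σ<-+ (suc n) (λ i → F i (suc k) ℚ.* denom (n ∸ i) 0) (λ i → F i k ℚ.* denom (n ∸ i) 1) ⟩
  ℚΣ.Σ< (suc n) (λ i → F i (suc k) ℚ.* denom (n ∸ i) 0) ℚ.+ ℚΣ.Σ< (suc n) (λ i → F i k ℚ.* denom (n ∸ i) 1)
    ≡⟨ cong₂ ℚ._+_ constant-term linear-term ⟩
  F n (suc k) ℚ.- ℚΣ.Σ< n (λ i → F i k ℚ.* invFact (n ∸ i)) ∎
  where
  open ≡-Reasoning
  constant-term : ℚΣ.Σ< (suc n) (λ i → F i (suc k) ℚ.* denom (n ∸ i) 0) ≡ F n (suc k)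
  constant-term = trans (ℚΣ.Σ<-cong (suc n) (λ {i} _ → cong (F i (suc k) ℚ.*_) (denom-0 (n ∸ i))))
                        (Σ<-*one n (λ i → F i (suc k)))
  below-n : ∀ {i} → i < n → F i k ℚ.* denom (n ∸ i) 1 ≡ ℚ.- (F i k ℚ.* invFact (n ∸ i))
  below-n {i} i<n = trans (cong (F i k ℚ.*_) (denom-1-pos (m<n⇒0<n∸m i<n))) (sym (ℚₚ.neg-distribʳ-* (F i k) _))
  linear-term : ℚΣ.Σ< (suc n) (λ i → F i k ℚ.* denom (n ∸ i) 1) ≡ ℚ.- ℚΣ.Σ< n (λ i → F i k ℚ.* invFact (n ∸ i))
  linear-term = begin
    ℚΣ.Σ< (suc n) (λ i → F i k ℚ.* denom (n ∸ i) 1)                        ≡⟨ ℚΣ.Σ<-suc n (λ i → F i k ℚ.* denom (n ∸ i) 1) ⟩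
    ℚΣ.Σ< n (λ i → F i k ℚ.* denom (n ∸ i) 1) ℚ.+ F n k ℚ.* denom (n ∸ n) 1  ≡⟨ cong₂ ℚ._+_ (ℚΣ.Σ<-cong n below-n) top-vanishes ⟩
    ℚΣ.Σ< n (λ i → ℚ.- (F i k ℚ.* invFact (n ∸ i))) ℚ.+ 0ℚ                  ≡⟨ ℚₚ.+-identityʳ _ ⟩
    ℚΣ.Σ< n (λ i → ℚ.- (F i k ℚ.* invFact (n ∸ i)))                        ≡⟨ Σ<-neg n (λ i → F i k ℚ.* invFact (n ∸ i)) ⟩
    ℚ.- ℚΣ.Σ< n (λ i → F i k ℚ.* invFact (n ∸ i))                          ∎
    where
    top-vanishes : F n k ℚ.* denom (n ∸ n) 1 ≡ 0ℚ
    top-vanishes = trans (cong (λ d → F n k ℚ.* denom d 1) (n∸n≡0 n)) (ℚₚ.*-zeroʳ (F n k))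

theorem2p11 : (n k : ℕ) → (fubiniEGF ⊛ denom) n k ≡ one n k
theorem2p11 n zero    = trans (⊛-denom-zero fubiniEGF n) (fubiniEGF-zero n)
theorem2p11 n (suc k) = begin
  (fubiniEGF ⊛ denom) n (suc k)                                              ≡⟨ ⊛-denom-suc fubiniEGF n k ⟩
  fubiniEGF n (suc k) ℚ.- ℚΣ.Σ< n (λ i → fubiniEGF i k ℚ.* invFact (n ∸ i))  ≡⟨ cong (λ x → fubiniEGF n (suc k) ℚ.- x) (fubiniEGF-suc n k) ⟨
  fubiniEGF n (suc k) ℚ.- fubiniEGF n (suc k)                                ≡⟨ ℚₚ.+-inverseʳ (fubiniEGF n (suc k)) ⟩
  0ℚ                                                                         ≡⟨ one-suc n k ⟨
  one n (suc k)                                                              ∎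
  where open ≡-Reasoning
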